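{- Let $J$ be a set of pairwise disjoint delivery intervals with costs $0<c_j\le B$, and let $m$ be the number of drones opened by GreedyAlgoModified on $J$. Then $\mathcal{W}(J)>\frac{m-1}{2}\,B$, where $\mathcal{W}(J)=\sum_{I_j\in J}c_j$.
   Context: $B>0$ is the battery budget of identical drones. GreedyAlgoModified on a set $J$ of pairwise disjoint intervals: process the intervals of $J$ one by one; for the current interval $I_j$, take an opened drone with maximum remaining capacity (remaining capacity = $B$ minus the total cost already assigned to it); if that capacity is at least $c_j$, assign $I_j$ to this drone, otherwise (or if no drone is open) open a new drone and assign $I_j$ to it. It returns the number $m$ of opened drones and their assignments.
   Formalization: The battery budget B, the costs $c_j$ and the endpoints of the delivery intervals are rational. -}

module Defs where

open import Data.Rational using (ℚ; 0ℚ; _+_; _-_; _*_; _≤_; _<_; _≤ᵇ_; _⊔_; _/_)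
open import Data.Integer using (+_)
open import Data.Nat using (ℕ)
open import Data.Bool using (Bool; true; false; if_then_else_)
open import Data.List using (List; []; _∷_; _++_; length; foldr; map; foldl)
open import Data.List.Relation.Unary.All using (All)
open import Data.List.Relation.Unary.AllPairs using (AllPairs)
open import Data.Product using (_×_; _,_; proj₁; proj₂)
open import Data.Sum using (_⊎_)

Interval : Set
Interval = (ℚ × ℚ) × ℚ

start end cost : Interval → ℚ
start i = proj₁ (proj₁ i)
end   i = proj₂ (proj₁ i)
cost  i = proj₂ i

Disjoint : Interval → Interval → Set
Disjoint i j = (end i < start j) ⊎ (end j < start i)

W : List Interval → ℚ
W = foldr (λ i acc → cost i + acc) 0ℚ

maxRem : ℚ → List ℚ → ℚ
maxRem m [] = m
maxRem m (r ∷ rs) = maxRem (m ⊔ r) rs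

assignTo : ℚ → ℚ → List ℚ → List ℚ
assignTo M c [] = []
assignTo M c (r ∷ rs) with r ≤ᵇ M | M ≤ᵇ r
... | true | true = (r - c) ∷ rs
... | _    | _    = r ∷ assignTo M c rs

-- One greedy step; the state is the list of remaining capacities of opened drones.
greedyStep : ℚ → List ℚ → ℚ → List ℚ
greedyStep B [] c = (B - c) ∷ []
greedyStep B (r ∷ rs) c =
  let M = maxRem r rs in
  if c ≤ᵇ M then assignTo M c (r ∷ rs) else (r ∷ rs) ++ ((B - c) ∷ [])

greedyRems : ℚ → List Interval → List ℚ
greedyRems B J = foldl (λ st i → greedyStep B st (cost i)) [] J

greedyDrones : ℚ → List Interval → ℕ
greedyDrones B J = length (greedyRems B J)

toℚ : ℕ → ℚ
toℚ n = (+ n) / 1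

-- Let m be the number of open drones, w the total cost assigned so far and S the sum of the
-- remaining capacities, so that w + S = m B.  The greedy run keeps (m - 1) B/2 < w.
-- Assigning to an open drone raises w and keeps m.  A new drone is opened for a cost c only
-- when c exceeds every remaining capacity: if c ≥ B/2, then w + c > m B/2 directly; otherwise
-- every open drone has remaining capacity below B/2, so S ≤ m B/2 and already w ≥ m B/2.
module Submission where

open import Defs
open import Data.Rational using (ℚ; 0ℚ; 1ℚ; _+_; _-_; -_; _*_; _/_; _≤_; _<_; _≤ᵇ_; _⊔_; mkℚ; NonNegative)
open import Data.Rational.Properties
open import Data.Rational.Solver using (module +-*-Solver)
open import Data.Integer using (+_)
import Data.Integer as ℤ
import Data.Integer.Properties as ℤ
open import Data.Nat using (suc)
import Data.Nat.Properties as ℕ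
open import Data.Nat.Coprimality using (1-coprimeTo) renaming (sym to coprime-sym)
open import Data.Bool using (T; true; false)
open import Data.Empty using (⊥-elim)
open import Data.List using (List; []; _∷_; _∷ʳ_; length; foldr; foldl)
open import Data.List.Properties using (length-++)
open import Data.List.Membership.Propositional using (_∈_)
open import Data.List.Relation.Unary.All as All using (All; []; _∷_)
open import Data.List.Relation.Unary.Any using (here; there)
open import Data.List.Relation.Unary.AllPairs using (AllPairs)
open import Data.Product using (_×_; proj₁)
open import Data.Sum using (inj₁; inj₂)
open import Relation.Binary.PropositionalEquality

open +-*-Solver

toℚ≡mkℚ : ∀ n → toℚ n ≡ mkℚ (+ n) 0 (coprime-sym (1-coprimeTo n))
toℚ≡mkℚ n = normalize-coprime (coprime-sym (1-coprimeTo n))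

toℚ-suc : ∀ n → toℚ (suc n) ≡ 1ℚ + toℚ n
toℚ-suc n = begin
  (+ suc n) / 1                                     ≡⟨ cong (λ k → (+ 1 ℤ.+ k) / 1) (ℤ.*-identityʳ (+ n)) ⟨
  (+ 1 ℤ.+ + n ℤ.* + 1) / 1                         ≡⟨⟩
  1ℚ + mkℚ (+ n) 0 (coprime-sym (1-coprimeTo n))    ≡⟨ cong (λ q → 1ℚ + q) (toℚ≡mkℚ n) ⟨
  1ℚ + toℚ n                                        ∎
  where open ≡-Reasoning

toℚ-nonNeg : ∀ n → NonNegative (toℚ n)
toℚ-nonNeg n = normalize-nonNeg n 1

toℚ-length-∷ʳ : ∀ {A : Set} (xs : List A) y → toℚ (length (xs ∷ʳ y)) ≡ 1ℚ + toℚ (length xs)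
toℚ-length-∷ʳ xs y = trans (cong toℚ (trans (length-++ xs) (ℕ.+-comm (length xs) 1))) (toℚ-suc (length xs))

p<p+q : ∀ p {q} → 0ℚ < q → p < p + q
p<p+q p 0<q = <-respˡ-≡ (+-identityʳ p) (+-monoʳ-< p 0<q)

≤ᵇ≡false⇒> : ∀ {p q} → (p ≤ᵇ q) ≡ false → q < p
≤ᵇ≡false⇒> p≰ᵇq = ≰⇒> (λ p≤q → subst T p≰ᵇq (≤⇒≤ᵇ p≤q))

p≤ᵇp≢false : ∀ p → (p ≤ᵇ p) ≢ false
p≤ᵇp≢false p p≰ᵇp = <-irrefl refl (≤ᵇ≡false⇒> {p} {p} p≰ᵇp)

+-minus-assoc : ∀ p q r → p + (q - r) ≡ (p + q) - r
+-minus-assoc = solve 3 (λ p q r → p :+ (q :- r) := (p :+ q) :- r) refl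

sumℚ : List ℚ → ℚ
sumℚ = foldr _+_ 0ℚ

sumℚ-∷ʳ : ∀ xs y → sumℚ (xs ∷ʳ y) ≡ sumℚ xs + y
sumℚ-∷ʳ []       y = trans (+-identityʳ y) (sym (+-identityˡ y))
sumℚ-∷ʳ (x ∷ xs) y = trans (cong (λ s → x + s) (sumℚ-∷ʳ xs y)) (sym (+-assoc x (sumℚ xs) y))

sumℚ≤length*bound : ∀ {M} xs → All (_≤ M) xs → sumℚ xs ≤ toℚ (length xs) * M
sumℚ≤length*bound {M} []       []          = ≤-reflexive (sym (*-zeroˡ M))
sumℚ≤length*bound {M} (x ∷ xs) (x≤M ∷ xs≤M) = begin
  x + sumℚ xs               ≤⟨ +-mono-≤ x≤M (sumℚ≤length*bound xs xs≤M) ⟩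
  M + n * M                 ≡⟨ solve 2 (λ m n → m :+ n :* m := (con 1ℚ :+ n) :* m) refl M n ⟩
  (1ℚ + n) * M              ≡⟨ cong (_* M) (toℚ-suc (length xs)) ⟨
  toℚ (length (x ∷ xs)) * M ∎
  where
  n : ℚ
  n = toℚ (length xs)
  open ≤-Reasoning

maxRem-upperBound : ∀ m rs → All (_≤ maxRem m rs) (m ∷ rs)
maxRem-upperBound m []       = ≤-refl ∷ []
maxRem-upperBound m (r ∷ rs) with maxRem-upperBound (m ⊔ r) rs
... | m⊔r≤M ∷ rs≤M = ≤-trans (p≤p⊔q m r) m⊔r≤M ∷ ≤-trans (p≤q⊔p m r) m⊔r≤M ∷ rs≤M

maxRem-∈ : ∀ m rs → maxRem m rs ∈ m ∷ rs
maxRem-∈ m []       = here refl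
maxRem-∈ m (r ∷ rs) with maxRem-∈ (m ⊔ r) rs
... | there M∈rs = there (there M∈rs)
... | here M≡m⊔r with ⊔-sel m r
...   | inj₁ m⊔r≡m = here (trans M≡m⊔r m⊔r≡m)
...   | inj₂ m⊔r≡r = there (here (trans M≡m⊔r m⊔r≡r))

length-assignTo : ∀ M c xs → length (assignTo M c xs) ≡ length xs
length-assignTo M c []       = refl
length-assignTo M c (r ∷ rs) with r ≤ᵇ M | M ≤ᵇ r
... | true  | true  = refl
... | true  | false = cong suc (length-assignTo M c rs)
... | false | _     = cong suc (length-assignTo M c rs)

sumℚ-assignTo : ∀ {M} c {xs} → M ∈ xs → sumℚ (assignTo M c xs) ≡ sumℚ xs - c
sumℚ-assignTo {M} c {r ∷ rs} M∈ with r ≤ᵇ M in r≤ᵇM | M ≤ᵇ r in M≤ᵇr | M∈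
... | true  | true  | _           = solve 3 (λ r c s → (r :- c) :+ s := (r :+ s) :- c) refl r c (sumℚ rs)
... | true  | false | here refl   = ⊥-elim (p≤ᵇp≢false M M≤ᵇr)
... | false | _     | here refl   = ⊥-elim (p≤ᵇp≢false M r≤ᵇM)
... | true  | false | there M∈rs  = trans (cong (λ s → r + s) (sumℚ-assignTo c M∈rs)) (+-minus-assoc r (sumℚ rs) c)
... | false | _     | there M∈rs  = trans (cong (λ s → r + s) (sumℚ-assignTo c M∈rs)) (+-minus-assoc r (sumℚ rs) c)

module GreedyInvariant (B h : ℚ) (h+h≡B : h + h ≡ B) where

  record Invariant (caps : List ℚ) (w : ℚ) : Set where
    field
      conservation : w + sumℚ caps ≡ toℚ (length caps) * B
      lowerBound   : (toℚ (length caps) - 1ℚ) * h < w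

  open Invariant

  Invariant-[] : 0ℚ < h → Invariant [] 0ℚ
  Invariant-[] 0<h = record
    { conservation = sym (*-zeroˡ B)
    ; lowerBound   = begin-strict
        (0ℚ - 1ℚ) * h ≡⟨ solve 1 (λ h → (con 0ℚ :- con 1ℚ) :* h := con 0ℚ :- h) refl h ⟩
        0ℚ - h        <⟨ +-monoʳ-< 0ℚ (neg-antimono-< 0<h) ⟩
        0ℚ - 0ℚ       ≡⟨⟩
        0ℚ            ∎
    }
    where open ≤-Reasoning

  Invariant-assignTo : ∀ {M caps w c} → M ∈ caps → 0ℚ < c → Invariant caps w →
                       Invariant (assignTo M c caps) (w + c)
  Invariant-assignTo {M} {caps} {w} {c} M∈ 0<c inv = record
    { conservation = begin
        (w + c) + sumℚ (assignTo M c caps) ≡⟨ cong (λ s → (w + c) + s) (sumℚ-assignTo c M∈) ⟩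
        (w + c) + (sumℚ caps - c)           ≡⟨ solve 3 (λ w c s → (w :+ c) :+ (s :- c) := w :+ s) refl w c (sumℚ caps) ⟩
        w + sumℚ caps                       ≡⟨ conservation inv ⟩
        toℚ (length caps) * B               ≡⟨ cong (λ n → toℚ n * B) same-length ⟨
        toℚ (length (assignTo M c caps)) * B ∎
    ; lowerBound = <-respˡ-≡ (cong (λ n → (toℚ n - 1ℚ) * h) (sym same-length))
                             (<-trans (lowerBound inv) (p<p+q w 0<c))
    }
    where
    same-length : length (assignTo M c caps) ≡ length caps
    same-length = length-assignTo M c caps
    open ≡-Reasoning

  caps≤h⇒length*h≤w : ∀ {caps w} → Invariant caps w → All (_≤ h) caps → toℚ (length caps) * h ≤ w
  caps≤h⇒length*h≤w {caps} {w} inv caps≤h = begin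
    m * h                   ≡⟨ solve 2 (λ a s → a := (a :+ s) :- s) refl (m * h) S ⟩
    (m * h + S) - S         ≤⟨ +-monoˡ-≤ (- S) (+-monoʳ-≤ (m * h) S≤m*h) ⟩
    (m * h + m * h) - S     ≡⟨ cong (_- S) w+S≡m*h+m*h ⟨
    (w + S) - S             ≡⟨ solve 2 (λ a s → (a :+ s) :- s := a) refl w S ⟩
    w                       ∎
    where
    m S : ℚ
    m = toℚ (length caps)
    S = sumℚ caps
    instance
      m-nonNeg : NonNegative m
      m-nonNeg = toℚ-nonNeg (length caps)
    S≤m*h : S ≤ m * h
    S≤m*h = sumℚ≤length*bound caps caps≤h
    w+S≡m*h+m*h : w + S ≡ m * h + m * h
    w+S≡m*h+m*h = trans (conservation inv) (trans (cong (m *_) (sym h+h≡B)) (*-distribˡ-+ m h h))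
    open ≤-Reasoning

  opening-lowerBound : ∀ {caps w c} → All (_< c) caps → 0ℚ < c → Invariant caps w →
                       toℚ (length caps) * h < w + c
  opening-lowerBound {caps} {w} {c} caps<c 0<c inv with ≤-total h c
  ... | inj₁ h≤c = <-respˡ-≡ (solve 2 (λ m h → (m :- con 1ℚ) :* h :+ h := m :* h) refl m h)
                             (+-mono-<-≤ (lowerBound inv) h≤c)
    where
    m : ℚ
    m = toℚ (length caps)
  ... | inj₂ c≤h = ≤-<-trans (caps≤h⇒length*h≤w inv (All.map (λ r<c → <⇒≤ (<-≤-trans r<c c≤h)) caps<c))
                             (p<p+q w 0<c)

  Invariant-open : ∀ {caps w c} → All (_< c) caps → 0ℚ < c → Invariant caps w →
                   Invariant (caps ∷ʳ (B - c)) (w + c)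
  Invariant-open {caps} {w} {c} caps<c 0<c inv = record
    { conservation = begin
        (w + c) + sumℚ (caps ∷ʳ (B - c)) ≡⟨ cong (λ s → (w + c) + s) (sumℚ-∷ʳ caps (B - c)) ⟩
        (w + c) + (S + (B - c))           ≡⟨ solve 4 (λ w c s b → (w :+ c) :+ (s :+ (b :- c)) := (w :+ s) :+ b) refl w c S B ⟩
        (w + S) + B                       ≡⟨ cong (_+ B) (conservation inv) ⟩
        m * B + B                         ≡⟨ solve 2 (λ m b → m :* b :+ b := (con 1ℚ :+ m) :* b) refl m B ⟩
        (1ℚ + m) * B                      ≡⟨ cong (_* B) m+1 ⟨
        toℚ (length (caps ∷ʳ (B - c))) * B ∎
    ; lowerBound = <-respˡ-≡ (trans (solve 2 (λ m h → m :* h := ((con 1ℚ :+ m) :- con 1ℚ) :* h) refl m h)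
                                    (cong (λ k → (k - 1ℚ) * h) (sym m+1)))
                             (opening-lowerBound caps<c 0<c inv)
    }
    where
    m S : ℚ
    m = toℚ (length caps)
    S = sumℚ caps
    m+1 : toℚ (length (caps ∷ʳ (B - c))) ≡ 1ℚ + m
    m+1 = toℚ-length-∷ʳ caps (B - c)
    open ≡-Reasoning

  Invariant-greedyStep : ∀ {caps w c} → 0ℚ < c → Invariant caps w → Invariant (greedyStep B caps c) (w + c)
  Invariant-greedyStep {[]}     0<c inv = Invariant-open [] 0<c inv
  Invariant-greedyStep {r ∷ rs} {c = c} 0<c inv with c ≤ᵇ maxRem r rs in c≤ᵇM
  ... | true  = Invariant-assignTo (maxRem-∈ r rs) 0<c inv
  ... | false = Invariant-open caps<c 0<c inv
    where
    caps<c : All (_< c) (r ∷ rs)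
    caps<c = All.map (λ x≤M → ≤-<-trans x≤M (≤ᵇ≡false⇒> c≤ᵇM)) (maxRem-upperBound r rs)

  Invariant-greedy : ∀ J {caps w} → All (λ I → 0ℚ < cost I) J → Invariant caps w →
                     Invariant (foldl (λ st i → greedyStep B st (cost i)) caps J) (w + W J)
  Invariant-greedy []      {caps} {w} []         inv = subst (Invariant caps) (sym (+-identityʳ w)) inv
  Invariant-greedy (i ∷ J) {caps} {w} (0<c ∷ cs) inv =
    subst (Invariant _) (+-assoc w (cost i) (W J)) (Invariant-greedy J cs (Invariant-greedyStep 0<c inv))

lemma4p4 : (B : ℚ) → 0ℚ < B → (J : List Interval) →
    AllPairs Disjoint J →
    All (λ I → (0ℚ < cost I) × (cost I ≤ B)) J →
    ((toℚ (greedyDrones B J) - 1ℚ) * (B * ((+ 1) / 2))) < W J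
lemma4p4 B 0<B J _ costs =
  <-respʳ-≡ (+-identityˡ (W J)) (Invariant.lowerBound (Invariant-greedy J (All.map proj₁ costs) (Invariant-[] 0<h)))
  where
  h : ℚ
  h = B * ((+ 1) / 2)
  h+h≡B : h + h ≡ B
  h+h≡B = trans (sym (*-distribˡ-+ B ((+ 1) / 2) ((+ 1) / 2))) (*-identityʳ B)
  0<h : 0ℚ < h
  0<h = *-monoˡ-<-pos ((+ 1) / 2) 0<B
  open GreedyInvariant B h h+h≡B
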